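{- Let $c\ge3$ be a constant and let $\sigma\in\Sigma$ satisfy $\sigma(i,n-i)\in\{0,1\}$ for every $n\ge2$ and $1\le i\le n-1$, and $\sum_{\frac nc\le k\le n-\frac nc}\sigma(k,n-k)\ge1$ for every $n\ge2$ (i.e., the unique $k(n)$ with $\sigma(k(n),n-k(n))=1$ satisfies $n/c\le k(n)\le n-n/c$). Then $\mathcal{D}_\sigma(n)\in\mathcal{O}(\sqrt n)$.
   Context: Binary trees are terms over a leaf symbol $a$ and a binary symbol $f$: $a$ is a binary tree, and if $t_1,t_2$ are binary trees then so is $f(t_1,t_2)$. $|t|$ is the number of leaves of $t$, $\mathcal{T}_n$ the set of binary trees with $n$ leaves. $|\mathcal{D}_t|$ (the size of the minimal DAG of $t$) is the number of pairwise non-isomorphic subtrees of $t$. $\Sigma$ is the set of functions $\sigma:(\mathbb{N}\setminus\{0\})^2\to[0,1]$ with $\sum_{i,j\ge1,\, i+j=k}\sigma(i,j)=1$ for every integer $k\ge2$. For $\sigma\in\Sigma$, $P_\sigma(a)=1$ and $P_\sigma(f(u,v))=\sigma(|u|,|v|)P_\sigma(u)P_\sigma(v)$, and $\mathcal{D}_\sigma(n)=\sum_{t\in\mathcal{T}_n}P_\sigma(t)|\mathcal{D}_t|$. A sum $\sum_{q_0\le k\le q_1}$ with rational bounds ranges over integers $k$ from $\lceil q_0\rceil$ to $\lfloor q_1\rfloor$. -}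

module Defs where

open import Data.Nat as ℕ using (ℕ; zero; suc; _∸_)
import Data.Nat.Properties as ℕP
open import Data.Integer using (+_)
open import Data.Rational as ℚ using (ℚ; 0ℚ; 1ℚ; _/_)
open import Data.Rational.Properties using (_≤?_)
open import Data.List using (List; []; _∷_; _++_; map; concatMap; foldr; filter; length; deduplicate)
open import Data.Product using (_×_; _,_)
open import Relation.Binary.PropositionalEquality using (_≡_; refl; cong₂)
open import Relation.Nullary using (Dec; yes; no)
open import Relation.Nullary.Decidable using (_×-dec_)
open import Data.Bool using (Bool; true; false; if_then_else_)

data Tree : Set where
  a : Tree
  f : Tree → Tree → Tree

∣_∣ : Tree → ℕ
∣ a ∣ = 1
∣ f u v ∣ = ∣ u ∣ ℕ.+ ∣ v ∣

-- decidable equality of trees (syntactic equality = isomorphism of subtrees)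
_≟T_ : (s t : Tree) → Dec (s ≡ t)
a ≟T a = yes refl
a ≟T f _ _ = no (λ ())
f _ _ ≟T a = no (λ ())
f u v ≟T f u' v' with u ≟T u' | v ≟T v'
... | yes refl | yes refl = yes refl
... | no p | _ = no (λ { refl → p refl })
... | yes _ | no q = no (λ { refl → q refl })

subtrees : Tree → List Tree
subtrees a = a ∷ []
subtrees (f u v) = f u v ∷ (subtrees u ++ subtrees v)

dagSize : Tree → ℕ
dagSize t = length (deduplicate _≟T_ (subtrees t))

range1 : ℕ → List ℕ
range1 zero = []
range1 (suc m) = range1 m ++ (suc m ∷ [])

-- enumeration of 𝒯_n with fuel (fuel n suffices, see treesOf)
treesF : ℕ → ℕ → List Tree
treesF zero n = []
treesF (suc fuel) zero = []
treesF (suc fuel) (suc zero) = a ∷ []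
treesF (suc fuel) (suc (suc m)) =
  concatMap (λ i → concatMap (λ u → map (f u) (treesF fuel (suc (suc m) ∸ i)))
                             (treesF fuel i))
            (range1 (suc m))

-- 𝒯_n : the list of all binary trees with n leaves (each exactly once)
treesOf : ℕ → List Tree
treesOf n = treesF n n

ℕtoℚ : ℕ → ℚ
ℕtoℚ n = (+ n) / 1

sumℚ : List ℚ → ℚ
sumℚ = foldr ℚ._+_ 0ℚ

-- σ ∈ Σ  (σ is given on all of ℕ², only positive arguments are relevant)
InΣ : (ℕ → ℕ → ℚ) → Set
InΣ σ = (∀ i j → 1 ℕ.≤ i → 1 ℕ.≤ j → (0ℚ ℚ.≤ σ i j) × (σ i j ℚ.≤ 1ℚ))
      × (∀ k → 2 ℕ.≤ k → sumℚ (map (λ i → σ i (k ∸ i)) (range1 (k ∸ 1))) ≡ 1ℚ)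

Pσ : (ℕ → ℕ → ℚ) → Tree → ℚ
Pσ σ a = 1ℚ
Pσ σ (f u v) = σ ∣ u ∣ ∣ v ∣ ℚ.* (Pσ σ u ℚ.* Pσ σ v)

Dσ : (ℕ → ℕ → ℚ) → ℕ → ℚ
Dσ σ n = sumℚ (map (λ t → Pσ σ t ℚ.* ℕtoℚ (dagSize t)) (treesOf n))

-- membership of k in the rational interval [n/c , n - n/c], for c > 0,
-- written without division:  n/c ≤ k  ⇔  n ≤ c·k,   k ≤ n - n/c ⇔ c·k ≤ c·n - n
inBand : ℚ → ℕ → ℕ → Bool
inBand c n k with ℕtoℚ n ≤? c ℚ.* ℕtoℚ k | c ℚ.* ℕtoℚ k ≤? (c ℚ.* ℕtoℚ n ℚ.- ℕtoℚ n)
... | yes _ | yes _ = true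
... | _ | _ = false

-- Σ_{n/c ≤ k ≤ n - n/c} σ(k, n-k)   (such k automatically satisfy 1 ≤ k ≤ n-1)
bandSum : (ℕ → ℕ → ℚ) → ℚ → ℕ → ℚ
bandSum σ c n = sumℚ (map (λ k → if inBand c n k then σ k (n ∸ k) else 0ℚ) (range1 n))

module Submission where

-- Since σ is {0,1}-valued, P_σ is the indicator of the "conforming" trees
-- (those following σ at every node), and as the σ(i, n-i) sum to 1, a
-- conforming tree is determined by its size.  As P_σ is a probability
-- distribution on 𝒯_n, 𝒟_σ(n) is bounded by any bound on |𝒟_t| for conforming
-- t with n leaves.  The band makes conforming trees C-balanced (C ∈ ℕ, C ≥ c),
-- and a C-balanced tree has fewer than C|t|/s subtree occurrences of size ≥ s;
-- the distinct smaller subtrees have distinct sizes, so |𝒟_t| ≤ s + C|t|/s,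
-- which is O(√n) for s = ⌊√n⌋.

open import Defs
open import Data.Nat using (ℕ; _≤_; _*_; _∸_)
open import Data.Rational using (ℚ; 0ℚ; 1ℚ; _≥_)
open import Data.Product using (Σ; ∃; _×_)
open import Data.Sum using (_⊎_)
open import Relation.Binary.PropositionalEquality using (_≡_)
import Data.Rational as Q

open import Data.Nat using (zero; suc; _+_; _<_; z≤n; s≤s; _≤?_; >-nonZero)
open import Data.Nat.Properties
open import Data.Nat.GCD using (gcd-zeroʳ)
open import Data.Nat.Coprimality using (gcd≡1⇒coprime)
open import Data.Integer as ℤ using (+_; -[1+_]; +≤+)
import Data.Integer.Properties as ℤP
import Data.Rational.Properties as QP
open import Data.Rational.Solver using (module +-*-Solver)
open import Data.Nat.Solver renaming (module +-*-Solver to ℕ-Solver)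
open import Data.Bool using (true; false; if_then_else_)
open import Data.List using (List; []; _∷_; _++_; map; concatMap; length; filter; deduplicate)
open import Data.List.Properties using (length-++; map-∘; filter-accept; filter-++; filter-none)
open import Data.List.Membership.Propositional using (_∈_)
open import Data.List.Membership.Propositional.Properties
  using (∈-++⁺ˡ; ∈-++⁺ʳ; ∈-++⁻; ∈-filter⁺; ∈-filter⁻; ∈-deduplicate⁻)
open import Data.List.Relation.Unary.Any using (here; there)
open import Data.List.Relation.Unary.All as All using (All; []; _∷_)
import Data.List.Relation.Unary.All.Properties as AllP
open import Data.List.Relation.Unary.Unique.Propositional using (Unique)
open import Data.List.Relation.Unary.AllPairs using (_∷_)
import Data.List.Relation.Unary.Unique.Propositional.Properties as UniqueP
import Data.List.Relation.Unary.Unique.DecPropositional.Properties as DecUniqueP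
open import Data.Product using (_,_; proj₁; proj₂)
open import Data.Sum using (inj₁; inj₂)
open import Data.Empty using (⊥-elim)
open import Data.Unit using (⊤; tt)
open import Relation.Nullary using (Dec; yes; no; ¬_; ¬?)
open import Relation.Binary.Definitions using (DecidableEquality)
open import Relation.Binary.PropositionalEquality
  using (_≢_; refl; sym; trans; cong; cong₂; subst; subst₂; module ≡-Reasoning)
open import Function using (_∘_)

ℕtoℚ-canonical : ∀ n → ℕtoℚ n ≡ Q.mkℚ (+ n) 0 (gcd≡1⇒coprime (gcd-zeroʳ n))
ℕtoℚ-canonical n = QP.normalize-coprime (gcd≡1⇒coprime (gcd-zeroʳ n))

ℕtoℚ-+ : ∀ m n → ℕtoℚ (m + n) ≡ ℕtoℚ m Q.+ ℕtoℚ n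
ℕtoℚ-+ m n rewrite ℕtoℚ-canonical m | ℕtoℚ-canonical n =
  cong (Q._/ 1) (sym (cong₂ ℤ._+_ (ℤP.*-identityʳ (+ m)) (ℤP.*-identityʳ (+ n))))

ℕtoℚ-* : ∀ m n → ℕtoℚ (m * n) ≡ ℕtoℚ m Q.* ℕtoℚ n
ℕtoℚ-* m n rewrite ℕtoℚ-canonical m | ℕtoℚ-canonical n = cong (Q._/ 1) (ℤP.pos-* m n)

ℕtoℚ-mono-≤ : ∀ {m n} → m ≤ n → ℕtoℚ m Q.≤ ℕtoℚ n
ℕtoℚ-mono-≤ {m} {n} m≤n rewrite ℕtoℚ-canonical m | ℕtoℚ-canonical n =
  Q.*≤* (ℤP.*-monoʳ-≤-nonNeg (+ 1) (+≤+ m≤n))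

ℕtoℚ-cancel-≤ : ∀ {m n} → ℕtoℚ m Q.≤ ℕtoℚ n → m ≤ n
ℕtoℚ-cancel-≤ {m} {n} m≤n rewrite ℕtoℚ-canonical m | ℕtoℚ-canonical n =
  ℤP.drop‿+≤+ (subst₂ ℤ._≤_ (ℤP.*-identityʳ (+ m)) (ℤP.*-identityʳ (+ n)) (QP.drop-*≤* m≤n))

ℕtoℚ-nonNeg : ∀ n → 0ℚ Q.≤ ℕtoℚ n
ℕtoℚ-nonNeg n = ℕtoℚ-mono-≤ {0} {n} z≤n

ℕtoℚ-∸ : ∀ {m n} → n ≤ m → ℕtoℚ (m ∸ n) ≡ ℕtoℚ m Q.- ℕtoℚ n
ℕtoℚ-∸ {m} {n} n≤m = begin
  D                      ≡⟨ solve 2 (λ x y → x := (x :+ y) :- y) refl D N ⟩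
  (D Q.+ N) Q.- N        ≡⟨ cong (Q._- N) (sym (ℕtoℚ-+ (m ∸ n) n)) ⟩
  ℕtoℚ (m ∸ n + n) Q.- N ≡⟨ cong (λ z → ℕtoℚ z Q.- N) (m∸n+n≡m n≤m) ⟩
  ℕtoℚ m Q.- N           ∎
  where
  open ≡-Reasoning
  open +-*-Solver
  D = ℕtoℚ (m ∸ n)
  N = ℕtoℚ n

natural-upper-bound : ∀ q → ∃ λ C → q Q.≤ ℕtoℚ C
natural-upper-bound q@(Q.mkℚ (+ k) _ _) =
  k , subst (q Q.≤_) (sym (ℕtoℚ-canonical k)) (Q.*≤* (ℤP.*-monoˡ-≤-nonNeg (+ k) (+≤+ (s≤s z≤n))))
natural-upper-bound q@(Q.mkℚ -[1+ k ] _ _) =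
  0 , subst (q Q.≤_) (sym (ℕtoℚ-canonical 0))
        (Q.*≤* (subst (ℤ._≤ + 0) (sym (ℤP.*-identityʳ -[1+ k ])) ℤ.-≤+))

swap-subtrahend : ∀ p q r → r Q.≤ p Q.- q → q Q.≤ p Q.- r
swap-subtrahend p q r r≤p-q = subst₂ Q._≤_ left right (QP.+-monoˡ-≤ (q Q.- r) r≤p-q)
  where
  open +-*-Solver
  left : r Q.+ (q Q.- r) ≡ q
  left = solve 2 (λ q r → r :+ (q :- r) := q) refl q r
  right : (p Q.- q) Q.+ (q Q.- r) ≡ p Q.- r
  right = solve 3 (λ p q r → (p :- q) :+ (q :- r) := p :- r) refl p q r

square-bound : ∀ {D} B M → 0ℚ Q.≤ D → D Q.≤ ℕtoℚ B → B * B ≤ M → D Q.* D Q.≤ ℕtoℚ M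
square-bound {D} B M 0≤D D≤B B²≤M = begin
  D Q.* D               ≤⟨ QP.*-monoˡ-≤-nonNeg D {{Q.nonNegative 0≤D}} D≤B ⟩
  D Q.* ℕtoℚ B          ≤⟨ QP.*-monoʳ-≤-nonNeg (ℕtoℚ B) {{Q.nonNegative (ℕtoℚ-nonNeg B)}} D≤B ⟩
  ℕtoℚ B Q.* ℕtoℚ B     ≡⟨ sym (ℕtoℚ-* B B) ⟩
  ℕtoℚ (B * B)          ≤⟨ ℕtoℚ-mono-≤ B²≤M ⟩
  ℕtoℚ M                ∎
  where open QP.≤-Reasoning

≤-respˡ : ∀ {p q r} → p ≡ q → p Q.≤ r → q Q.≤ r
≤-respˡ refl p≤r = p≤r

sum-++ : ∀ {A : Set} (g : A → ℚ) xs ys → sumℚ (map g (xs ++ ys)) ≡ sumℚ (map g xs) Q.+ sumℚ (map g ys)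
sum-++ g [] ys = sym (QP.+-identityˡ _)
sum-++ g (x ∷ xs) ys = trans (cong (g x Q.+_) (sum-++ g xs ys)) (sym (QP.+-assoc (g x) _ _))

module _ {A : Set} where

  sum-concatMap : ∀ {B : Set} (g : B → ℚ) (h : A → List B) xs →
    sumℚ (map g (concatMap h xs)) ≡ sumℚ (map (λ x → sumℚ (map g (h x))) xs)
  sum-concatMap g h [] = refl
  sum-concatMap g h (x ∷ xs) =
    trans (sum-++ g (h x) (concatMap h xs)) (cong (sumℚ (map g (h x)) Q.+_) (sum-concatMap g h xs))

  sum-cong : ∀ {g h : A → ℚ} xs → All (λ x → g x ≡ h x) xs → sumℚ (map g xs) ≡ sumℚ (map h xs)
  sum-cong [] [] = refl
  sum-cong (x ∷ xs) (e ∷ es) = cong₂ Q._+_ e (sum-cong xs es)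

  sum-scale : ∀ k (g : A → ℚ) xs → sumℚ (map (λ x → k Q.* g x) xs) ≡ k Q.* sumℚ (map g xs)
  sum-scale k g [] = sym (QP.*-zeroʳ k)
  sum-scale k g (x ∷ xs) = trans (cong (k Q.* g x Q.+_) (sum-scale k g xs)) (sym (QP.*-distribˡ-+ k (g x) _))

  sum-mono : ∀ {g h : A → ℚ} xs → All (λ x → g x Q.≤ h x) xs →
    sumℚ (map g xs) Q.≤ sumℚ (map h xs)
  sum-mono [] [] = QP.≤-refl
  sum-mono (x ∷ xs) (e ∷ es) = QP.+-mono-≤ e (sum-mono xs es)

  sum-nonNeg : ∀ {g : A → ℚ} xs → All (λ x → 0ℚ Q.≤ g x) xs → 0ℚ Q.≤ sumℚ (map g xs)
  sum-nonNeg [] [] = QP.≤-refl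
  sum-nonNeg (x ∷ xs) (e ∷ es) = ≤-respˡ (QP.+-identityˡ 0ℚ) (QP.+-mono-≤ e (sum-nonNeg xs es))

  term≤sum : ∀ {g : A → ℚ} {x} xs → All (λ x → 0ℚ Q.≤ g x) xs → x ∈ xs →
    g x Q.≤ sumℚ (map g xs)
  term≤sum {g} (x ∷ xs) (e ∷ es) (here refl) =
    ≤-respˡ (QP.+-identityʳ (g x)) (QP.+-monoʳ-≤ (g x) (sum-nonNeg xs es))
  term≤sum {g} {y} (x ∷ xs) (e ∷ es) (there y∈xs) =
    ≤-respˡ (QP.+-identityˡ (g y)) (QP.+-mono-≤ e (term≤sum xs es y∈xs))

  two-terms≤sum : ∀ {g : A → ℚ} {x y} xs → All (λ x → 0ℚ Q.≤ g x) xs →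
    x ∈ xs → y ∈ xs → x ≢ y → g x Q.+ g y Q.≤ sumℚ (map g xs)
  two-terms≤sum (x ∷ xs) (e ∷ es) (here refl) (here refl) x≢y = ⊥-elim (x≢y refl)
  two-terms≤sum {g} (x ∷ xs) (e ∷ es) (here refl) (there y∈xs) _ =
    QP.+-monoʳ-≤ (g x) (term≤sum xs es y∈xs)
  two-terms≤sum {g} {y} (x ∷ xs) (e ∷ es) (there y∈xs) (here refl) _ =
    ≤-respˡ (QP.+-comm (g x) (g y)) (QP.+-monoʳ-≤ (g x) (term≤sum xs es y∈xs))
  two-terms≤sum {g} {y} {z} (x ∷ xs) (e ∷ es) (there y∈xs) (there z∈xs) y≢z =
    ≤-respˡ (QP.+-identityˡ (g y Q.+ g z)) (QP.+-mono-≤ e (two-terms≤sum xs es y∈xs z∈xs y≢z))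

  nonzero-term : ∀ (g : A → ℚ) xs → sumℚ (map g xs) ≢ 0ℚ → ∃ λ x → x ∈ xs × g x ≢ 0ℚ
  nonzero-term g [] sum≢0 = ⊥-elim (sum≢0 refl)
  nonzero-term g (x ∷ xs) sum≢0 with g x QP.≟ 0ℚ
  ... | no gx≢0 = x , here refl , gx≢0
  ... | yes gx≡0 with nonzero-term g xs (λ rest≡0 → sum≢0 (cong₂ Q._+_ gx≡0 rest≡0))
  ...   | y , y∈xs , gy≢0 = y , there y∈xs , gy≢0

range1-bounds : ∀ m → All (λ i → 1 ≤ i × i ≤ m) (range1 m)
range1-bounds zero = []
range1-bounds (suc m) =
  AllP.++⁺ (All.map (λ (1≤i , i≤m) → 1≤i , m≤n⇒m≤1+n i≤m) (range1-bounds m))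
           ((s≤s z≤n , ≤-refl) ∷ [])

range1-∈ : ∀ {i} m → 1 ≤ i → i ≤ m → i ∈ range1 m
range1-∈ zero 1≤i i≤0 = ⊥-elim (<⇒≱ 1≤i i≤0)
range1-∈ {i} (suc m) 1≤i i≤1+m with i ≟ suc m
... | yes refl = ∈-++⁺ʳ (range1 m) (here refl)
... | no i≢1+m = ∈-++⁺ˡ (range1-∈ m 1≤i (m<1+n⇒m≤n (≤∧≢⇒< i≤1+m i≢1+m)))

range1-length : ∀ m → length (range1 m) ≡ m
range1-length zero = refl
range1-length (suc m) =
  trans (length-++ (range1 m)) (trans (+-comm (length (range1 m)) 1) (cong suc (range1-length m)))

size-pos : ∀ t → 1 ≤ ∣ t ∣
size-pos a = s≤s z≤n
size-pos (f u v) = ≤-trans (size-pos u) (m≤m+n ∣ u ∣ ∣ v ∣)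

subtree-size : ∀ {x} t → x ∈ subtrees t → ∣ x ∣ ≤ ∣ t ∣
subtree-size a (here refl) = ≤-refl
subtree-size (f u v) (here refl) = ≤-refl
subtree-size (f u v) (there x∈uv) with ∈-++⁻ (subtrees u) x∈uv
... | inj₁ x∈u = ≤-trans (subtree-size u x∈u) (m≤m+n ∣ u ∣ ∣ v ∣)
... | inj₂ x∈v = ≤-trans (subtree-size v x∈v) (m≤n+m ∣ v ∣ ∣ u ∣)

node-size : ∀ u v → 2 ≤ ∣ f u v ∣
node-size u v = +-mono-≤ (size-pos u) (size-pos v)

left-split : ∀ u v → 1 ≤ ∣ u ∣ × ∣ u ∣ ≤ ∣ f u v ∣ ∸ 1
left-split u v = size-pos u , subst (∣ u ∣ ≤_) (sym (+-∸-assoc ∣ u ∣ (size-pos v))) (m≤m+n ∣ u ∣ _)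

treesF-size : ∀ fuel m → All (λ t → ∣ t ∣ ≡ m) (treesF fuel m)
treesF-size zero m = []
treesF-size (suc fuel) zero = []
treesF-size (suc fuel) (suc zero) = refl ∷ []
treesF-size (suc fuel) (suc (suc m)) =
  allConcatMap (range1 (suc m)) (All.map (λ {i} (_ , i≤1+m) →
    allConcatMap (treesF fuel i) (All.map (λ {u} ∣u∣≡i → AllP.map⁺ (All.map (λ {v} ∣v∣≡rest →
      trans (cong₂ _+_ ∣u∣≡i ∣v∣≡rest) (m+[n∸m]≡n (m≤n⇒m≤1+n i≤1+m)))
      (treesF-size fuel (suc (suc m) ∸ i))))
    (treesF-size fuel i))) (range1-bounds (suc m)))
  where
  allConcatMap : ∀ {A B : Set} {P : B → Set} {g : A → List B} xs →
    All (λ x → All P (g x)) xs → All P (concatMap g xs)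
  allConcatMap xs h = AllP.concat⁺ (AllP.map⁺ h)

Pσ-total : ∀ σ → InΣ σ → ∀ fuel m → 1 ≤ m → m ≤ fuel →
  sumℚ (map (Pσ σ) (treesF fuel m)) ≡ 1ℚ
Pσ-total σ σ∈Σ (suc fuel) (suc zero) _ _ = QP.+-identityʳ 1ℚ
Pσ-total σ σ∈Σ (suc fuel) (suc (suc m)) _ (s≤s 1+m≤fuel) = begin
  sumℚ (map P (treesF (suc fuel) n))
    ≡⟨ sum-concatMap P _ (range1 (suc m)) ⟩
  sumℚ (map (λ i → sumℚ (map P (splitAt i))) (range1 (suc m)))
    ≡⟨ sum-cong (range1 (suc m))
         (All.map (λ (1≤i , i≤1+m) → split-total _ 1≤i i≤1+m) (range1-bounds (suc m))) ⟩
  sumℚ (map (λ i → σ i (n ∸ i)) (range1 (suc m)))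
    ≡⟨ proj₂ σ∈Σ n (s≤s (s≤s z≤n)) ⟩
  1ℚ ∎
  where
  open ≡-Reasoning
  P = Pσ σ
  n = suc (suc m)
  splitAt : ℕ → List Tree
  splitAt i = concatMap (λ u → map (f u) (treesF fuel (n ∸ i))) (treesF fuel i)
  split-total : ∀ i → 1 ≤ i → i ≤ suc m → sumℚ (map P (splitAt i)) ≡ σ i (n ∸ i)
  split-total i 1≤i i≤1+m = begin
    sumℚ (map P (splitAt i))
      ≡⟨ sum-concatMap P _ (treesF fuel i) ⟩
    sumℚ (map (λ u → sumℚ (map P (map (f u) (treesF fuel j)))) (treesF fuel i))
      ≡⟨ sum-cong (treesF fuel i) (All.map right-total (treesF-size fuel i)) ⟩
    sumℚ (map (λ u → σ i j Q.* P u) (treesF fuel i))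
      ≡⟨ sum-scale (σ i j) P (treesF fuel i) ⟩
    σ i j Q.* sumℚ (map P (treesF fuel i))
      ≡⟨ cong (σ i j Q.*_) (Pσ-total σ σ∈Σ fuel i 1≤i (≤-trans i≤1+m 1+m≤fuel)) ⟩
    σ i j Q.* 1ℚ
      ≡⟨ QP.*-identityʳ (σ i j) ⟩
    σ i j ∎
    where
    j = n ∸ i
    right-total : ∀ {u} → ∣ u ∣ ≡ i → sumℚ (map P (map (f u) (treesF fuel j))) ≡ σ i j Q.* P u
    right-total {u} ∣u∣≡i = begin
      sumℚ (map P (map (f u) (treesF fuel j)))
        ≡⟨ cong sumℚ (sym (map-∘ (treesF fuel j))) ⟩
      sumℚ (map (P ∘ f u) (treesF fuel j))
        ≡⟨ sum-cong (treesF fuel j) (All.map (λ {v} ∣v∣≡j →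
             trans (cong₂ (λ x y → σ x y Q.* (P u Q.* P v)) ∣u∣≡i ∣v∣≡j)
                   (sym (QP.*-assoc (σ i j) (P u) (P v))))
             (treesF-size fuel j)) ⟩
      sumℚ (map (λ v → σ i j Q.* P u Q.* P v) (treesF fuel j))
        ≡⟨ sum-scale (σ i j Q.* P u) P (treesF fuel j) ⟩
      σ i j Q.* P u Q.* sumℚ (map P (treesF fuel j))
        ≡⟨ cong (σ i j Q.* P u Q.*_)
             (Pσ-total σ σ∈Σ fuel j (m<n⇒0<n∸m (s≤s i≤1+m)) (≤-trans (∸-monoʳ-≤ n 1≤i) 1+m≤fuel)) ⟩
      σ i j Q.* P u Q.* 1ℚ
        ≡⟨ QP.*-identityʳ _ ⟩
      σ i j Q.* P u ∎

module _ {B : Set} (_≟_ : DecidableEquality B) where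

  remove : B → List B → List B
  remove y [] = []
  remove y (z ∷ zs) with y ≟ z
  ... | yes _ = zs
  ... | no _ = z ∷ remove y zs

  remove-length : ∀ y zs → y ∈ zs → suc (length (remove y zs)) ≡ length zs
  remove-length y (z ∷ zs) y∈ with y ≟ z
  ... | yes _ = refl
  ... | no y≢z with y∈
  ...   | here y≡z = ⊥-elim (y≢z y≡z)
  ...   | there y∈zs = cong suc (remove-length y zs y∈zs)

  remove-keeps : ∀ y {x} zs → x ∈ zs → x ≢ y → x ∈ remove y zs
  remove-keeps y (z ∷ zs) x∈ x≢y with y ≟ z
  remove-keeps y (z ∷ zs) (here x≡z) x≢y | yes refl = ⊥-elim (x≢y x≡z)
  remove-keeps y (z ∷ zs) (there x∈zs) x≢y | yes refl = x∈zs
  remove-keeps y (z ∷ zs) (here x≡z) x≢y | no _ = here x≡z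
  remove-keeps y (z ∷ zs) (there x∈zs) x≢y | no _ = there (remove-keeps y zs x∈zs x≢y)

  pigeonhole : ∀ {A : Set} (g : A → B) {xs ys} → Unique xs →
    (∀ {x y} → x ∈ xs → y ∈ xs → g x ≡ g y → x ≡ y) → (∀ {x} → x ∈ xs → g x ∈ ys) →
    length xs ≤ length ys
  pigeonhole g {[]} _ _ _ = z≤n
  pigeonhole g {x ∷ xs} {ys} (x∉xs ∷ xs!) inj into =
    subst (suc (length xs) ≤_) (remove-length (g x) ys (into (here refl)))
      (s≤s (pigeonhole g xs! (λ p q → inj (there p) (there q)) into-rest))
    where
    into-rest : ∀ {z} → z ∈ xs → g z ∈ remove (g x) ys
    into-rest z∈xs = remove-keeps (g x) ys (into (there z∈xs))
      (λ gz≡gx → All.lookup x∉xs z∈xs (sym (inj (there z∈xs) (here refl) gz≡gx)))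

-- Counting large subtrees of balanced trees

Balanced : ℕ → Tree → Set
Balanced C a = ⊤
Balanced C (f u v) =
  (∣ f u v ∣ ≤ C * ∣ u ∣) × (∣ f u v ∣ ≤ C * ∣ v ∣) × Balanced C u × Balanced C v

isLarge : ∀ s x → Dec (s ≤ ∣ x ∣)
isLarge s x = s ≤? ∣ x ∣

large : ℕ → Tree → List Tree
large s t = filter (isLarge s) (subtrees t)

large-empty : ∀ s t → ∣ t ∣ < s → large s t ≡ []
large-empty s t ∣t∣<s = filter-none (isLarge s)
  (All.tabulate (λ x∈t s≤x → <⇒≱ ∣t∣<s (≤-trans s≤x (subtree-size t x∈t))))

large-node : ∀ s u v → s ≤ ∣ f u v ∣ →
  length (large s (f u v)) ≡ suc (length (large s u) + length (large s v))
large-node s u v s≤t = begin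
  length (large s (f u v))
    ≡⟨ cong length (filter-accept (isLarge s) s≤t) ⟩
  suc (length (filter (isLarge s) (subtrees u ++ subtrees v)))
    ≡⟨ cong (suc ∘ length) (filter-++ (isLarge s) (subtrees u) (subtrees v)) ⟩
  suc (length (large s u ++ large s v))
    ≡⟨ cong suc (length-++ (large s u)) ⟩
  suc (length (large s u) + length (large s v)) ∎
  where open ≡-Reasoning

large-count : ∀ C s t → 2 ≤ C → Balanced C t → s ≤ ∣ t ∣ →
  s * (length (large s t) + 1) ≤ C * ∣ t ∣
large-count C s a 2≤C _ s≤1 = begin
  s * (length (large s a) + 1) ≡⟨ cong (λ L → s * (L + 1)) (cong length (filter-accept (isLarge s) s≤1)) ⟩
  s * 2                        ≤⟨ *-monoˡ-≤ 2 s≤1 ⟩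
  2                            ≤⟨ 2≤C ⟩
  C                            ≡⟨ sym (*-identityʳ C) ⟩
  C * 1                        ∎
  where open ≤-Reasoning
large-count C s (f u v) 2≤C (u-big , v-big , u-bal , v-bal) s≤t = begin
  s * (length (large s (f u v)) + 1) ≡⟨ cong (λ L → s * (L + 1)) (large-node s u v s≤t) ⟩
  s * (suc (Lu + Lv) + 1)            ≡⟨ solve 3 (λ s x y → s :* (con 1 :+ (x :+ y) :+ con 1)
                                              := s :* (x :+ con 1) :+ s :* (y :+ con 1)) refl s Lu Lv ⟩
  s * (Lu + 1) + s * (Lv + 1)        ≤⟨ +-mono-≤ (child u u-big u-bal) (child v v-big v-bal) ⟩
  C * ∣ u ∣ + C * ∣ v ∣              ≡⟨ sym (*-distribˡ-+ C ∣ u ∣ ∣ v ∣) ⟩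
  C * (∣ u ∣ + ∣ v ∣)                ∎
  where
  open ≤-Reasoning
  open ℕ-Solver
  Lu = length (large s u)
  Lv = length (large s v)
  -- a small child has no large subtrees, and is still charged at most s ≤ |t|
  child : ∀ x → ∣ u ∣ + ∣ v ∣ ≤ C * ∣ x ∣ → Balanced C x →
    s * (length (large s x) + 1) ≤ C * ∣ x ∣
  child x x-big x-bal with s ≤? ∣ x ∣
  ... | yes s≤x = large-count C s x 2≤C x-bal s≤x
  ... | no s≰x = begin
    s * (length (large s x) + 1) ≡⟨ cong (λ L → s * (length L + 1)) (large-empty s x (≰⇒> s≰x)) ⟩
    s * 1                        ≡⟨ *-identityʳ s ⟩
    s                            ≤⟨ s≤t ⟩
    ∣ u ∣ + ∣ v ∣                ≤⟨ x-big ⟩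
    C * ∣ x ∣                    ∎

-- The DAG size of trees whose subtrees are determined by their size

length-split : ∀ {A : Set} {P : A → Set} (P? : ∀ x → Dec (P x)) xs →
  length xs ≡ length (filter P? xs) + length (filter (¬? ∘ P?) xs)
length-split P? [] = refl
length-split P? (x ∷ xs) with P? x
... | yes _ = cong suc (length-split P? xs)
... | no _ = trans (cong suc (length-split P? xs)) (sym (+-suc _ _))

-- If equal-sized subtrees of t coincide, the distinct subtrees of t are the
-- large ones (at most the number of large occurrences) plus at most one of
-- each size below s.
dag-bound : ∀ s t → (∀ {x y} → x ∈ subtrees t → y ∈ subtrees t → ∣ x ∣ ≡ ∣ y ∣ → x ≡ y) →
  dagSize t ≤ s + length (large s t)
dag-bound s t size-determines = begin
  length distinct                                            ≡⟨ length-split (isLarge s) distinct ⟩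
  length (filter (isLarge s) distinct) + length smallDistinct ≤⟨ +-mono-≤ few-large few-small ⟩
  length (large s t) + s                                     ≡⟨ +-comm _ s ⟩
  s + length (large s t)                                     ∎
  where
  open ≤-Reasoning
  distinct = deduplicate _≟T_ (subtrees t)
  smallDistinct = filter (¬? ∘ isLarge s) distinct
  distinct! : Unique distinct
  distinct! = DecUniqueP.deduplicate-! _≟T_ (subtrees t)
  is-subtree : ∀ {x} → x ∈ distinct → x ∈ subtrees t
  is-subtree = ∈-deduplicate⁻ _≟T_ (subtrees t)
  -- the large distinct subtrees occur among the large occurrences
  few-large : length (filter (isLarge s) distinct) ≤ length (large s t)
  few-large = pigeonhole _≟T_ (λ x → x) (UniqueP.filter⁺ (isLarge s) distinct!) (λ _ _ x≡y → x≡y)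
    (λ x∈ → let (x∈distinct , x-large) = ∈-filter⁻ (isLarge s) x∈ in
            ∈-filter⁺ (isLarge s) (is-subtree x∈distinct) x-large)
  -- the small distinct subtrees inject, via their sizes, into [1, …, s]
  few-small : length smallDistinct ≤ s
  few-small = subst (length smallDistinct ≤_) (range1-length s)
    (pigeonhole _≟_ ∣_∣ (UniqueP.filter⁺ (¬? ∘ isLarge s) distinct!)
      (λ x∈ y∈ → size-determines (is-subtree (proj₁ (∈-filter⁻ (¬? ∘ isLarge s) x∈)))
                                 (is-subtree (proj₁ (∈-filter⁻ (¬? ∘ isLarge s) y∈))))
      (λ {x} x∈ → range1-∈ s (size-pos x)
                    (<⇒≤ (≰⇒> (proj₂ (∈-filter⁻ (¬? ∘ isLarge s) {xs = distinct} x∈))))))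

isqrt : ∀ n → ∃ λ s → (s * s ≤ n) × (n < suc s * suc s)
isqrt zero = 0 , z≤n , s≤s z≤n
isqrt (suc n) with isqrt n
... | s , s²≤n , n<[s+1]² with suc (suc n) ≤? suc s * suc s
...   | yes n+1<[s+1]² = s , m≤n⇒m≤1+n s²≤n , n+1<[s+1]²
...   | no n+1≮[s+1]² = suc s , ≤-reflexive (sym n+1≡[s+1]²) , n+1<[s+2]²
  where
  n+1≡[s+1]² : suc n ≡ suc s * suc s
  n+1≡[s+1]² = ≤-antisym n<[s+1]² (≮⇒≥ n+1≮[s+1]²)
  n+1<[s+2]² : suc n < suc (suc s) * suc (suc s)
  n+1<[s+2]² = subst (_< suc (suc s) * suc (suc s)) (sym n+1≡[s+1]²) (*-mono-< (n<1+n (suc s)) (n<1+n (suc s)))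

-- With s = ⌊√n⌋ ≥ 1, a count L with s·(L+1) ≤ C·n satisfies s + L ≤ (1+4C)·s,
-- because n < (s+1)² ≤ 4s².
sqrt-balance : ∀ C s n L → 1 ≤ s → n < suc s * suc s → s * (L + 1) ≤ C * n → s + L ≤ (1 + 4 * C) * s
sqrt-balance C s n L 1≤s n<[s+1]² charge = begin
  s + L          ≤⟨ +-monoʳ-≤ s (≤-trans (n≤1+n L) (subst (_≤ 4 * C * s) (+-comm L 1) L+1≤4Cs)) ⟩
  s + 4 * C * s  ≡⟨ solve 2 (λ C s → s :+ con 4 :* C :* s := (con 1 :+ con 4 :* C) :* s) refl C s ⟩
  (1 + 4 * C) * s ∎
  where
  open ≤-Reasoning
  open ℕ-Solver
  s+1≤2s : suc s ≤ 2 * s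
  s+1≤2s = subst₂ _≤_ (+-comm s 1) (solve 1 (λ s → s :+ s := con 2 :* s) refl s) (+-monoʳ-≤ s 1≤s)
  L+1≤4Cs : L + 1 ≤ 4 * C * s
  L+1≤4Cs = *-cancelˡ-≤ s {{>-nonZero 1≤s}} (begin
    s * (L + 1)             ≤⟨ charge ⟩
    C * n                   ≤⟨ *-monoʳ-≤ C (<⇒≤ n<[s+1]²) ⟩
    C * (suc s * suc s)     ≤⟨ *-monoʳ-≤ C (*-mono-≤ s+1≤2s s+1≤2s) ⟩
    C * (2 * s * (2 * s))   ≡⟨ solve 2 (λ C s → C :* (con 2 :* s :* (con 2 :* s))
                                              := s :* (con 4 :* C :* s)) refl C s ⟩
    s * (4 * C * s)         ∎)

scaled-square : ∀ K s n → s * s ≤ n → K * s * (K * s) ≤ K * K * n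
scaled-square K s n s²≤n = subst (_≤ K * K * n)
  (solve 2 (λ K s → K :* K :* (s :* s) := K :* s :* (K :* s)) refl K s) (*-monoʳ-≤ (K * K) s²≤n)
  where open ℕ-Solver

inBand-sound : ∀ c n k → inBand c n k ≡ true →
  (ℕtoℚ n Q.≤ c Q.* ℕtoℚ k) × (c Q.* ℕtoℚ k Q.≤ c Q.* ℕtoℚ n Q.- ℕtoℚ n)
inBand-sound c n k inside
  with ℕtoℚ n QP.≤? c Q.* ℕtoℚ k | c Q.* ℕtoℚ k QP.≤? c Q.* ℕtoℚ n Q.- ℕtoℚ n
... | yes lower | yes upper = lower , upper
... | yes _ | no _ = ⊥-elim (false≢true inside)
  where false≢true : false ≢ true
        false≢true ()
... | no _ | _ = ⊥-elim (false≢true inside)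
  where false≢true : false ≢ true
        false≢true ()

band-bounds : ∀ c C n k → 0ℚ Q.≤ c → c Q.≤ ℕtoℚ C → k ≤ n → inBand c n k ≡ true →
  (n ≤ C * k) × (n ≤ C * (n ∸ k))
band-bounds c C n k 0≤c c≤C k≤n inside = ℕtoℚ-cancel-≤ left-part , ℕtoℚ-cancel-≤ right-part
  where
  open QP.≤-Reasoning
  N = ℕtoℚ n
  K = ℕtoℚ k
  R = ℕtoℚ (n ∸ k)
  lower = proj₁ (inBand-sound c n k inside)
  upper = proj₂ (inBand-sound c n k inside)
  scale : ∀ m → c Q.* ℕtoℚ m Q.≤ ℕtoℚ (C * m)
  scale m = subst (c Q.* ℕtoℚ m Q.≤_) (sym (ℕtoℚ-* C m))
    (QP.*-monoʳ-≤-nonNeg (ℕtoℚ m) {{Q.nonNegative (ℕtoℚ-nonNeg m)}} c≤C)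
  left-part : N Q.≤ ℕtoℚ (C * k)
  left-part = QP.≤-trans lower (scale k)
  right-part : N Q.≤ ℕtoℚ (C * (n ∸ k))
  right-part = begin
    N                   ≤⟨ swap-subtrahend (c Q.* N) N (c Q.* K) upper ⟩
    c Q.* N Q.- c Q.* K ≡⟨ solve 3 (λ c N K → c :* N :- c :* K := c :* (N :- K)) refl c N K ⟩
    c Q.* (N Q.- K)     ≡⟨ cong (c Q.*_) (sym (ℕtoℚ-∸ k≤n)) ⟩
    c Q.* R             ≤⟨ scale (n ∸ k) ⟩
    ℕtoℚ (C * (n ∸ k))  ∎
    where open +-*-Solver

-- Trees built by a deterministic σ

ZeroOne : ℚ → Set
ZeroOne q = (q ≡ 0ℚ) ⊎ (q ≡ 1ℚ)

nonzero⇒one : ∀ {q} → ZeroOne q → q ≢ 0ℚ → q ≡ 1ℚ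
nonzero⇒one (inj₁ q≡0) q≢0 = ⊥-elim (q≢0 q≡0)
nonzero⇒one (inj₂ q≡1) _ = q≡1

product-zero : ∀ p q r → (p ≡ 0ℚ) ⊎ (q ≡ 0ℚ) ⊎ (r ≡ 0ℚ) → p Q.* (q Q.* r) ≡ 0ℚ
product-zero p q r (inj₁ refl) = QP.*-zeroˡ (q Q.* r)
product-zero p q r (inj₂ (inj₁ refl)) = trans (cong (p Q.*_) (QP.*-zeroˡ r)) (QP.*-zeroʳ p)
product-zero p q r (inj₂ (inj₂ refl)) = trans (cong (p Q.*_) (QP.*-zeroʳ q)) (QP.*-zeroʳ p)

module Deterministic (σ : ℕ → ℕ → ℚ) (σ∈Σ : InΣ σ)
  (σ-01 : ∀ n i → 2 ≤ n → 1 ≤ i → i ≤ n ∸ 1 → ZeroOne (σ i (n ∸ i))) where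

  P : Tree → ℚ
  P = Pσ σ

  σ-zeroOne : ∀ x y → 1 ≤ x → 1 ≤ y → ZeroOne (σ x y)
  σ-zeroOne x y 1≤x 1≤y = subst (λ z → ZeroOne (σ x z)) (m+n∸m≡n x y)
    (σ-01 (x + y) x (+-mono-≤ 1≤x 1≤y) 1≤x
      (subst (x ≤_) (sym (+-∸-assoc x 1≤y)) (m≤m+n x (y ∸ 1))))

  Conforming : Tree → Set
  Conforming a = ⊤
  Conforming (f u v) = (σ ∣ u ∣ ∣ v ∣ ≡ 1ℚ) × Conforming u × Conforming v

  P-indicator : ∀ t → (P t ≡ 0ℚ) ⊎ ((P t ≡ 1ℚ) × Conforming t)
  P-indicator a = inj₂ (refl , tt)
  P-indicator (f u v) with σ-zeroOne ∣ u ∣ ∣ v ∣ (size-pos u) (size-pos v) | P-indicator u | P-indicator v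
  ... | inj₁ σ≡0 | _ | _ = inj₁ (product-zero σuv (P u) (P v) (inj₁ σ≡0))
    where σuv = σ (∣ u ∣) (∣ v ∣)
  ... | inj₂ _ | inj₁ Pu≡0 | _ = inj₁ (product-zero σuv (P u) (P v) (inj₂ (inj₁ Pu≡0)))
    where σuv = σ (∣ u ∣) (∣ v ∣)
  ... | inj₂ _ | inj₂ _ | inj₁ Pv≡0 = inj₁ (product-zero σuv (P u) (P v) (inj₂ (inj₂ Pv≡0)))
    where σuv = σ (∣ u ∣) (∣ v ∣)
  ... | inj₂ σ≡1 | inj₂ (Pu≡1 , u-conf) | inj₂ (Pv≡1 , v-conf) =
        inj₂ (cong₂ Q._*_ σ≡1 (cong₂ Q._*_ Pu≡1 Pv≡1) , σ≡1 , u-conf , v-conf)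

  conforming-subtree : ∀ {x} t → Conforming t → x ∈ subtrees t → Conforming x
  conforming-subtree a t-conf (here refl) = t-conf
  conforming-subtree (f u v) t-conf (here refl) = t-conf
  conforming-subtree (f u v) (_ , u-conf , v-conf) (there x∈uv) with ∈-++⁻ (subtrees u) x∈uv
  ... | inj₁ x∈u = conforming-subtree u u-conf x∈u
  ... | inj₂ x∈v = conforming-subtree v v-conf x∈v

  -- Each m ≥ 2 has at most one σ-split size, since the σ(i, m-i) sum to 1.
  split-unique : ∀ m i j → 2 ≤ m → 1 ≤ i → i ≤ m ∸ 1 → 1 ≤ j → j ≤ m ∸ 1 →
    σ i (m ∸ i) ≡ 1ℚ → σ j (m ∸ j) ≡ 1ℚ → i ≡ j
  split-unique m i j 2≤m 1≤i i<m 1≤j j<m σi≡1 σj≡1 with i ≟ j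
  ... | yes i≡j = i≡j
  ... | no i≢j = ⊥-elim (two≰one (subst₂ Q._≤_ (cong₂ Q._+_ σi≡1 σj≡1) (proj₂ σ∈Σ m 2≤m)
          (two-terms≤sum (range1 (m ∸ 1)) nonNeg
             (range1-∈ (m ∸ 1) 1≤i i<m) (range1-∈ (m ∸ 1) 1≤j j<m) i≢j)))
    where
    two≰one : ¬ (1ℚ Q.+ 1ℚ Q.≤ 1ℚ)
    two≰one (Q.*≤* (+≤+ (s≤s ())))
    nonNeg : All (λ k → 0ℚ Q.≤ σ k (m ∸ k)) (range1 (m ∸ 1))
    nonNeg = All.map (λ {k} (1≤k , k<m) → proj₁ (proj₁ σ∈Σ k (m ∸ k) 1≤k
               (subst (_≤ m ∸ k) (m∸[m∸n]≡n (≤-trans (s≤s z≤n) 2≤m)) (∸-monoʳ-≤ m k<m))))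
             (range1-bounds (m ∸ 1))

  -- the σ-condition of a node, in the form σ(i, m - i) with m = |f u v|
  σ-at-left : ∀ u v → σ ∣ u ∣ ∣ v ∣ ≡ 1ℚ → σ ∣ u ∣ (∣ f u v ∣ ∸ ∣ u ∣) ≡ 1ℚ
  σ-at-left u v σ≡1 = trans (cong (σ ∣ u ∣) (m+n∸m≡n ∣ u ∣ ∣ v ∣)) σ≡1

  conforming-unique : ∀ t t' → Conforming t → Conforming t' → ∣ t ∣ ≡ ∣ t' ∣ → t ≡ t'
  conforming-unique a a _ _ _ = refl
  conforming-unique a (f u v) _ _ 1≡uv = ⊥-elim (<-irrefl 1≡uv (node-size u v))
  conforming-unique (f u v) a _ _ uv≡1 = ⊥-elim (<-irrefl (sym uv≡1) (node-size u v))
  conforming-unique (f u v) (f u' v') (σ≡1 , u-conf , v-conf) (σ'≡1 , u'-conf , v'-conf) same =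
    cong₂ f (conforming-unique u u' u-conf u'-conf same-left)
            (conforming-unique v v' v-conf v'-conf same-right)
    where
    same-left : ∣ u ∣ ≡ ∣ u' ∣
    same-left = split-unique (∣ f u v ∣) (∣ u ∣) (∣ u' ∣) (node-size u v)
      (proj₁ (left-split u v)) (proj₂ (left-split u v))
      (proj₁ (left-split u' v')) (subst (λ m → ∣ u' ∣ ≤ m ∸ 1) (sym same) (proj₂ (left-split u' v')))
      (σ-at-left u v σ≡1)
      (subst (λ m → σ ∣ u' ∣ (m ∸ ∣ u' ∣) ≡ 1ℚ) (sym same) (σ-at-left u' v' σ'≡1))
    same-right : ∣ v ∣ ≡ ∣ v' ∣
    same-right = +-cancelˡ-≡ ∣ u ∣ _ _ (trans same (cong (_+ ∣ v' ∣) (sym same-left)))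

  Dσ-bound : ∀ n B → 1 ≤ n → (∀ t → Conforming t → ∣ t ∣ ≡ n → dagSize t ≤ B) →
    (0ℚ Q.≤ Dσ σ n) × (Dσ σ n Q.≤ ℕtoℚ B)
  Dσ-bound n B 1≤n dag≤B =
    sum-nonNeg (treesOf n) (All.tabulate (λ {t} _ → proj₁ (term-bounds t))) ,
    (begin
      Dσ σ n
        ≤⟨ sum-mono (treesOf n) (All.map (λ {t} → proj₂ (term-bounds t)) (treesF-size n n)) ⟩
      sumℚ (map (λ t → ℕtoℚ B Q.* P t) (treesOf n))
        ≡⟨ sum-scale (ℕtoℚ B) P (treesOf n) ⟩
      ℕtoℚ B Q.* sumℚ (map P (treesOf n))
        ≡⟨ cong (ℕtoℚ B Q.*_) (Pσ-total σ σ∈Σ n n 1≤n ≤-refl) ⟩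
      ℕtoℚ B Q.* 1ℚ
        ≡⟨ QP.*-identityʳ (ℕtoℚ B) ⟩
      ℕtoℚ B ∎)
    where
    open QP.≤-Reasoning
    term : Tree → ℚ
    term t = P t Q.* ℕtoℚ (dagSize t)
    term-bounds : ∀ t → (0ℚ Q.≤ term t) × (∣ t ∣ ≡ n → term t Q.≤ ℕtoℚ B Q.* P t)
    term-bounds t = bounds (P-indicator t)
      where
      bounds : (P t ≡ 0ℚ) ⊎ ((P t ≡ 1ℚ) × Conforming t) →
        (0ℚ Q.≤ term t) × (∣ t ∣ ≡ n → term t Q.≤ ℕtoℚ B Q.* P t)
      bounds (inj₁ Pt≡0) =
        QP.≤-reflexive (sym term≡0) , λ _ → QP.≤-reflexive (trans term≡0 (sym B*P≡0))
        where
        term≡0 : term t ≡ 0ℚ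
        term≡0 = trans (cong (Q._* ℕtoℚ (dagSize t)) Pt≡0) (QP.*-zeroˡ (ℕtoℚ (dagSize t)))
        B*P≡0 : ℕtoℚ B Q.* P t ≡ 0ℚ
        B*P≡0 = trans (cong (ℕtoℚ B Q.*_) Pt≡0) (QP.*-zeroʳ (ℕtoℚ B))
      bounds (inj₂ (Pt≡1 , t-conf)) =
        subst (0ℚ Q.≤_) (sym term≡dag) (ℕtoℚ-nonNeg (dagSize t)) ,
        λ ∣t∣≡n → subst₂ Q._≤_ (sym term≡dag) (sym B*P≡B) (ℕtoℚ-mono-≤ (dag≤B t t-conf ∣t∣≡n))
        where
        term≡dag : term t ≡ ℕtoℚ (dagSize t)
        term≡dag = trans (cong (Q._* ℕtoℚ (dagSize t)) Pt≡1) (QP.*-identityˡ (ℕtoℚ (dagSize t)))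
        B*P≡B : ℕtoℚ B Q.* P t ≡ ℕtoℚ B
        B*P≡B = trans (cong (ℕtoℚ B Q.*_) Pt≡1) (QP.*-identityʳ (ℕtoℚ B))

selected : ∀ b (x : ℚ) → (if b then x else 0ℚ) ≢ 0ℚ → (b ≡ true) × (x ≢ 0ℚ)
selected true x x≢0 = refl , x≢0
selected false x 0≢0 = ⊥-elim (0≢0 refl)

proper-part : ∀ C n k → 1 ≤ n → n ≤ C * (n ∸ k) → k ≤ n ∸ 1
proper-part C (suc n) k _ n≤C[n-k] with suc n ≤? k
... | no n≰k = ≤-pred (≰⇒> n≰k)
... | yes n≤k = ⊥-elim (<⇒≱ (s≤s z≤n) n≤0)
  where
  n≤0 : suc n ≤ 0
  n≤0 = subst (suc n ≤_) (trans (cong (C *_) (m≤n⇒m∸n≡0 n≤k)) (*-zeroʳ C)) n≤C[n-k]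

-- Under the band condition every conforming tree is C-balanced, for a natural
-- number C ≥ c (also C ≥ 2, as the counting bound needs).
module BandBalanced (c : ℚ) (0≤c : 0ℚ Q.≤ c) (σ : ℕ → ℕ → ℚ) (σ∈Σ : InΣ σ)
  (σ-01 : ∀ n i → 2 ≤ n → 1 ≤ i → i ≤ n ∸ 1 → ZeroOne (σ i (n ∸ i)))
  (band : ∀ n → 2 ≤ n → bandSum σ c n ≥ 1ℚ) where

  open Deterministic σ σ∈Σ σ-01

  C : ℕ
  C = proj₁ (natural-upper-bound c) + 3

  BandWitness : ℕ → ℕ → Set
  BandWitness n k = (k ∈ range1 n) × (inBand c n k ≡ true) × (σ k (n ∸ k) ≢ 0ℚ)

  BalancedSplit : ℕ → ℕ → Set
  BalancedSplit n k = (1 ≤ k) × (k ≤ n ∸ 1) × (σ k (n ∸ k) ≡ 1ℚ) × (n ≤ C * k) × (n ≤ C * (n ∸ k))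

  c≤C : c Q.≤ ℕtoℚ C
  c≤C = QP.≤-trans (proj₂ (natural-upper-bound c))
                   (ℕtoℚ-mono-≤ (m≤m+n (proj₁ (natural-upper-bound c)) 3))

  2≤C : 2 ≤ C
  2≤C = ≤-trans (s≤s (s≤s z≤n)) (m≤n+m 3 (proj₁ (natural-upper-bound c)))

  band-witness : ∀ n → 2 ≤ n → ∃ (BandWitness n)
  band-witness n 2≤n =
    let (k , k∈range , term≢0) = nonzero-term term (range1 n) bandSum≢0
    in k , k∈range , selected (inBand c n k) (σ k (n ∸ k)) term≢0
    where
    term : ℕ → ℚ
    term k = if inBand c n k then σ k (n ∸ k) else 0ℚ
    bandSum≢0 : bandSum σ c n ≢ 0ℚ
    bandSum≢0 sum≡0 with subst (1ℚ Q.≤_) sum≡0 (band n 2≤n)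
    ... | Q.*≤* (+≤+ ())

  band-split : ∀ n → 2 ≤ n → ∃ (BalancedSplit n)
  band-split n 2≤n = split (band-witness n 2≤n)
    where
    -- (a function on the witness, so that inBand is never unfolded)
    split : ∃ (BandWitness n) → ∃ (BalancedSplit n)
    split (k , k∈range , inside , σ≢0) = k , 1≤k , k<n , σ≡1 , n≤Ck , n≤C[n-k]
      where
      1≤k : 1 ≤ k
      1≤k = proj₁ (All.lookup (range1-bounds n) k∈range)
      k≤n : k ≤ n
      k≤n = proj₂ (All.lookup (range1-bounds n) k∈range)
      n≤Ck : n ≤ C * k
      n≤Ck = proj₁ (band-bounds c C n k 0≤c c≤C k≤n inside)
      n≤C[n-k] : n ≤ C * (n ∸ k)
      n≤C[n-k] = proj₂ (band-bounds c C n k 0≤c c≤C k≤n inside)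
      k<n : k ≤ n ∸ 1
      k<n = proper-part C n k (≤-trans (s≤s z≤n) 2≤n) n≤C[n-k]
      σ≡1 : σ k (n ∸ k) ≡ 1ℚ
      σ≡1 = nonzero⇒one (σ-01 n k 2≤n 1≤k k<n) σ≢0

  -- Both children of a node that follows σ carry at least a 1/C fraction of its leaves.
  -- (σ's split of |f u v| is |u|, by uniqueness of the split).
  node-balanced : ∀ u v → σ ∣ u ∣ ∣ v ∣ ≡ 1ℚ → (∣ f u v ∣ ≤ C * ∣ u ∣) × (∣ f u v ∣ ≤ C * ∣ v ∣)
  node-balanced u v σ≡1 = balanced (band-split ∣ f u v ∣ (node-size u v))
    where
    m = ∣ f u v ∣
    balanced : ∃ (BalancedSplit m) → (m ≤ C * ∣ u ∣) × (m ≤ C * ∣ v ∣)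
    balanced (k , 1≤k , k<m , σk≡1 , m≤Ck , m≤C[m-k]) =
      subst (λ r → m ≤ C * r) k≡u m≤Ck ,
      subst (λ r → m ≤ C * r) (trans (cong (m ∸_) k≡u) (m+n∸m≡n ∣ u ∣ ∣ v ∣)) m≤C[m-k]
      where
      k≡u : k ≡ ∣ u ∣
      k≡u = split-unique m k (∣ u ∣) (node-size u v) 1≤k k<m
              (proj₁ (left-split u v)) (proj₂ (left-split u v)) σk≡1 (σ-at-left u v σ≡1)

  conforming-balanced : ∀ t → Conforming t → Balanced C t
  conforming-balanced a _ = tt
  conforming-balanced (f u v) (σ≡1 , u-conf , v-conf) =
    proj₁ (node-balanced u v σ≡1) , proj₂ (node-balanced u v σ≡1) ,
    conforming-balanced u u-conf , conforming-balanced v v-conf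

  conforming-dag : ∀ n s → 1 ≤ s → s * s ≤ n → n < suc s * suc s →
    ∀ t → Conforming t → ∣ t ∣ ≡ n → dagSize t ≤ (1 + 4 * C) * s
  conforming-dag n s 1≤s s²≤n n<[s+1]² t t-conf ∣t∣≡n = begin
    dagSize t              ≤⟨ dag-bound s t (λ {x} {y} x∈t y∈t → conforming-unique x y
                                (conforming-subtree t t-conf x∈t) (conforming-subtree t t-conf y∈t)) ⟩
    s + length (large s t) ≤⟨ sqrt-balance C s n _ 1≤s n<[s+1]² few-large ⟩
    (1 + 4 * C) * s        ∎
    where
    open ≤-Reasoning
    few-large : s * (length (large s t) + 1) ≤ C * n
    few-large = subst (λ m → s * (length (large s t) + 1) ≤ C * m) ∣t∣≡n
      (large-count C s t 2≤C (conforming-balanced t t-conf)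
         (subst (s ≤_) (sym ∣t∣≡n) (≤-trans (m≤m*n s s {{>-nonZero 1≤s}}) s²≤n)))

theorem3p21 : (c : ℚ) → c ≥ ℕtoℚ 3 →
  (σ : ℕ → ℕ → ℚ) → InΣ σ →
  (∀ n i → 2 ≤ n → 1 ≤ i → i ≤ n ∸ 1 → (σ i (n ∸ i) ≡ 0ℚ) ⊎ (σ i (n ∸ i) ≡ 1ℚ)) →
  (∀ n → 2 ≤ n → bandSum σ c n ≥ 1ℚ) →
  -- 𝒟_σ(n) ∈ O(√n):  ∃ C N, ∀ n ≥ N, 𝒟_σ(n) ≤ C √n  (squared, as 𝒟_σ(n) ≥ 0)
  ∃ λ (C : ℕ) → ∃ λ (N : ℕ) → ∀ n → N ≤ n →
    Dσ σ n Q.* Dσ σ n Q.≤ ℕtoℚ (C * C * n)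
-- With s = ⌊√n⌋, 𝒟_σ(n) ≤ (1 + 4C)·s by conforming-dag and Dσ-bound; squaring
-- gives 𝒟_σ(n)² ≤ (1 + 4C)²·n for all n ≥ 1.
theorem3p21 c 3≤c σ σ∈Σ σ-01 band = K , 1 , D²≤K²n
  where
  open Deterministic σ σ∈Σ σ-01
  open BandBalanced c (QP.≤-trans (ℕtoℚ-nonNeg 3) 3≤c) σ σ∈Σ σ-01 band
  K = 1 + 4 * C
  D²≤K²n : ∀ n → 1 ≤ n → Dσ σ n Q.* Dσ σ n Q.≤ ℕtoℚ (K * K * n)
  D²≤K²n n 1≤n = from-sqrt (isqrt n)
    where
    from-sqrt : (∃ λ s → (s * s ≤ n) × (n < suc s * suc s)) →
      Dσ σ n Q.* Dσ σ n Q.≤ ℕtoℚ (K * K * n)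
    from-sqrt (zero , _ , n<1) = ⊥-elim (<⇒≱ n<1 1≤n)
    from-sqrt (s@(suc _) , s²≤n , n<[s+1]²) =
      let (0≤D , D≤Ks) = Dσ-bound n (K * s) 1≤n (conforming-dag n s (s≤s z≤n) s²≤n n<[s+1]²)
      in square-bound (K * s) (K * K * n) 0≤D D≤Ks (scaled-square K s n s²≤n)
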